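{- For every positive integer $c$ there is a constant $C=C(c)$ such that the following holds. For all positive integers $r_1,\ldots,r_c$ and every collection of ordered stars $\mathcal{S}_1,\ldots,\mathcal{S}_c$, where $\mathcal{S}_i$ has $r_i$ vertices, we have \[\overline{R}(\mathcal{S}_1,\ldots,\mathcal{S}_c) \le C\cdot\max\{r_1,\ldots,r_c\}.\]
   Context: An ordered graph is a pair $(G,\prec)$ where $G$ is a finite simple graph and $\prec$ is a total ordering of $V(G)$. An ordered graph $(H,\prec_1)$ is contained in (is a copy inside) $(G,\prec_2)$ if there is an injection $V(H)\to V(G)$ that maps edges to edges and preserves the vertex orderings. $\mathcal{K}_N$ denotes the complete graph on $N$ vertices with a total ordering of its vertices (unique up to isomorphism). For ordered graphs $\mathcal{H}_1,\ldots,\mathcal{H}_c$, the ordered Ramsey number $\overline{R}(\mathcal{H}_1,\ldots,\mathcal{H}_c)$ is the smallest $N$ such that every coloring of the edges of $\mathcal{K}_N$ with colors $1,\ldots,c$ contains, for some $i$, a copy of $\mathcal{H}_i$ all of whose edges have color $i$. An ordered star is the star $K_{1,n-1}$ (one central vertex adjacent to all other $n-1$ vertices, no other edges) with an arbitrary total ordering of its vertices. -}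

module Defs where

open import Level using (0ℓ)
open import Data.Nat using (ℕ; zero; suc; _⊔_)
open import Data.Fin using (Fin; zero; suc; _<_)
open import Data.Product using (Σ; ∃; _×_; _,_)
open import Data.Sum using (_⊎_)
open import Relation.Binary.PropositionalEquality using (_≡_; _≢_)

-- An ordered graph: vertex set Fin n, ordered by the natural order of Fin,
-- with an adjacency relation (only consulted on pairs u < v, so a simple graph).
record OrderedGraph : Set₁ where
  field
    size : ℕ
    Adj  : Fin size → Fin size → Set

open OrderedGraph public

-- The ordered star K_{1,r-1} on r vertices whose centre is in position k.
-- Every ordered star on r vertices is isomorphic to exactly one of these.
star : (r : ℕ) → Fin r → OrderedGraph
star r k = record
  { size = r
  ; Adj  = λ u v → (u ≡ k × v ≢ k) ⊎ (v ≡ k × u ≢ k)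
  }

-- An edge colouring of the ordered complete graph K_N with colours Fin c;
-- the colour of the edge {x , y} with x < y is χ x y.
Colouring : ℕ → ℕ → Set
Colouring N c = Fin N → Fin N → Fin c

MonoCopy : (H : OrderedGraph) {N c : ℕ} → Colouring N c → Fin c → Set
MonoCopy H {N} χ col =
  Σ (Fin (size H) → Fin N) λ f →
    (∀ u v → u < v → f u < f v) ×
    (∀ u v → u < v → Adj H u v → χ (f u) (f v) ≡ col)

Arrows : (N : ℕ) {c : ℕ} → (Fin c → OrderedGraph) → Set
Arrows N {c} H = (χ : Colouring N c) → ∃ λ i → MonoCopy (H i) χ i

maxOf : {c : ℕ} → (Fin c → ℕ) → ℕ
maxOf {zero}  r = 0
maxOf {suc c} r = r zero ⊔ maxOf (λ i → r (suc i))

-- Put a(i) = position of the centre of S_i and b(i) = r_i - 1 - a(i), and let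
-- n = max r_i. A vertex v with a(i) left and b(i) right neighbours of colour i
-- is the centre of a copy of S_i. If no vertex is such a centre, then for every
-- v and i the left i-degree of v is below a(i) or the right one is below b(i),
-- and both bounds are at most n. Recording which of the two holds gives each
-- vertex one of 2^c types; some type class W has at least N / 2^c vertices.
-- Split W into its first 2cn + 1 vertices X and the rest Y. Charge each edge
-- x < y between X and Y to y if its colour is one where small left degree is
-- recorded, and to x otherwise; no vertex is charged more than cn times, so
-- |X| |Y| <= (|X| + |Y|) cn, which is false once |X|, |Y| > 2cn.
module Submission where

open import Defs
open import Data.Nat using (ℕ; _≤_; _*_)
open import Data.Fin using (Fin)
open import Data.Product using (Σ; ∃; _×_)

open import Data.Bool using (Bool; true; false; _∧_; not; T)
open import Data.Bool.Properties using (T-∧; ∧-identityʳ) renaming (_≟_ to _≟ᵇ_)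
open import Data.Empty using (⊥-elim)
open import Data.Fin as F using (zero; suc; toℕ; fromℕ<)
open import Data.Fin.Properties using (toℕ<n; toℕ-fromℕ<; any?)
  renaming (_<?_ to _<ᶠ?_; _≟_ to _≟ᶠ_)
open import Data.Nat using (zero; suc; _+_; _∸_; _^_; _<_; z≤n; s≤s; z<s; s<s; _<?_; _≤?_)
open import Data.Nat.Properties
open import Data.Nat.Tactic.RingSolver using (solve-∀)
open import Data.Product using (_,_; proj₁; proj₂)
open import Data.Sum using (_⊎_; inj₁; inj₂)
open import Data.Vec.Functional using (_∷_)
open import Function using (_∘_)
open import Function.Bundles using (module Equivalence)
open import Relation.Binary.Definitions using (Tri; tri<; tri≈; tri>)
open import Relation.Binary.PropositionalEquality
open import Relation.Nullary using (¬_; Dec; yes; no)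
open import Relation.Nullary.Decidable using (⌊_⌋; toWitness; fromWitness; toWitnessFalse; _×-dec_)
open import Algebra.Properties.Semiring.Sum +-*-semiring
  using (sum; sum-syntax; sum-cong-≗; sum-replicate-zero; ∑-comm; ∑-distrib-+; *-distribˡ-sum; *-distribʳ-sum)

open Equivalence using (to; from)

⟦_⟧ : Bool → ℕ
⟦ true ⟧  = 1
⟦ false ⟧ = 0

count : ∀ {N} → (Fin N → Bool) → ℕ
count {N} p = ∑[ x < N ] ⟦ p x ⟧

sum-mono : ∀ {N} {f g : Fin N → ℕ} → (∀ x → f x ≤ g x) → sum f ≤ sum g
sum-mono {zero}  f≤g = z≤n
sum-mono {suc N} f≤g = +-mono-≤ (f≤g zero) (sum-mono (f≤g ∘ suc))

∑-const : ∀ m k → ∑[ i < m ] k ≡ m * k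
∑-const zero    k = refl
∑-const (suc m) k = cong (k +_) (∑-const m k)

∑-select : ∀ {c} (f : Fin c → ℕ) i → ∑[ j < c ] (f j * ⟦ ⌊ i ≟ᶠ j ⌋ ⟧) ≡ f i
∑-select {suc c} f zero = begin
  f zero * 1 + ∑[ j < c ] (f (suc j) * 0) ≡⟨ cong₂ _+_ (*-identityʳ (f zero)) others-vanish ⟩
  f zero + 0                            ≡⟨ +-identityʳ (f zero) ⟩
  f zero                                ∎
  where
  open ≡-Reasoning
  others-vanish : ∑[ j < c ] (f (suc j) * 0) ≡ 0
  others-vanish = trans (sum-cong-≗ (*-zeroʳ ∘ f ∘ suc)) (sum-replicate-zero c)
∑-select {suc c} f (suc i) =
  trans (cong₂ _+_ (*-zeroʳ (f zero)) (sum-cong-≗ (cong (λ b → f (suc _) * ⟦ b ⟧) ∘ ⌊suc≟suc⌋)))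
        (∑-select (f ∘ suc) i)
  where
  ⌊suc≟suc⌋ : ∀ j → ⌊ suc i ≟ᶠ suc j ⌋ ≡ ⌊ i ≟ᶠ j ⌋
  ⌊suc≟suc⌋ j with i ≟ᶠ j
  ... | yes _ = refl
  ... | no _  = refl

∑-indicator-≤ : ∀ {N} (p : Fin N → Bool) (f : Fin N → ℕ) D →
  (∀ x → T (p x) → f x ≤ D) → ∑[ x < N ] (⟦ p x ⟧ * f x) ≤ count p * D
∑-indicator-≤ p f D f≤D = begin
  sum (λ x → ⟦ p x ⟧ * f x) ≤⟨ sum-mono (λ x → weight (p x) (f≤D x)) ⟩
  sum (λ x → ⟦ p x ⟧ * D)   ≡⟨ *-distribʳ-sum D (⟦_⟧ ∘ p) ⟨
  count p * D               ∎
  where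
  open ≤-Reasoning
  weight : ∀ b {k} → (T b → k ≤ D) → ⟦ b ⟧ * k ≤ ⟦ b ⟧ * D
  weight true  k≤D = *-monoʳ-≤ 1 (k≤D _)
  weight false _   = z≤n

count-cong : ∀ {N} {p q : Fin N → Bool} → (∀ x → p x ≡ q x) → count p ≡ count q
count-cong p≗q = sum-cong-≗ (cong ⟦_⟧ ∘ p≗q)

count-mono : ∀ {N} {p q : Fin N → Bool} → (∀ x → T (p x) → T (q x)) → count p ≤ count q
count-mono p⊆q = sum-mono (λ x → ⟦⟧-mono (p⊆q x))
  where
  ⟦⟧-mono : ∀ {a b} → (T a → T b) → ⟦ a ⟧ ≤ ⟦ b ⟧
  ⟦⟧-mono {false}         _   = z≤n
  ⟦⟧-mono {true} {true}   _   = ≤-refl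
  ⟦⟧-mono {true} {false} a⇒b = ⊥-elim (a⇒b _)

count-all : ∀ N → count {N} (λ _ → true) ≡ N
count-all N = trans (∑-const N 1) (*-identityʳ N)

count≤size : ∀ {N} (p : Fin N → Bool) → count p ≤ N
count≤size {N} p = ≤-trans (count-mono {p = p} {q = λ _ → true} (λ _ _ → _)) (≤-reflexive (count-all N))

count-split : ∀ {N} (p q : Fin N → Bool) →
  count p ≡ count (λ x → p x ∧ q x) + count (λ x → p x ∧ not (q x))
count-split p q = trans (sum-cong-≗ (λ x → split (p x) (q x)))
                        (∑-distrib-+ (λ x → ⟦ p x ∧ q x ⟧) (λ x → ⟦ p x ∧ not (q x) ⟧))
  where
  split : ∀ a b → ⟦ a ⟧ ≡ ⟦ a ∧ b ⟧ + ⟦ a ∧ not b ⟧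
  split true  true  = refl
  split true  false = refl
  split false _     = refl

count-by-colour : ∀ {N c} (A : Fin N → Bool) (e : Fin N → Fin c) (s : Fin c → Bool) →
  count (λ x → A x ∧ s (e x)) ≡ ∑[ j < c ] (⟦ s j ⟧ * count (λ x → A x ∧ ⌊ e x ≟ᶠ j ⌋))
count-by-colour {N} {c} A e s = begin
  count (λ x → A x ∧ s (e x))            ≡⟨ sum-cong-≗ (λ x → by-colour (A x) (e x)) ⟩
  ∑[ x < N ] ∑[ j < c ] term x j         ≡⟨ ∑-comm term ⟩
  ∑[ j < c ] ∑[ x < N ] term x j         ≡⟨ sum-cong-≗ (λ j → *-distribˡ-sum ⟦ s j ⟧ (⟦_⟧ ∘ in-colour j)) ⟨
  ∑[ j < c ] (⟦ s j ⟧ * count (in-colour j)) ∎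
  where
  open ≡-Reasoning
  in-colour : Fin c → Fin N → Bool
  in-colour j x = A x ∧ ⌊ e x ≟ᶠ j ⌋
  term : Fin N → Fin c → ℕ
  term x j = ⟦ s j ⟧ * ⟦ in-colour j x ⟧
  by-colour : ∀ a k → ⟦ a ∧ s k ⟧ ≡ ∑[ j < c ] (⟦ s j ⟧ * ⟦ a ∧ ⌊ k ≟ᶠ j ⌋ ⟧)
  by-colour true  k = sym (∑-select (⟦_⟧ ∘ s) k)
  by-colour false k = sym (trans (sum-cong-≗ (*-zeroʳ ∘ ⟦_⟧ ∘ s)) (sum-replicate-zero c))

count-by-colour-≤ : ∀ {N c} (A : Fin N → Bool) (e : Fin N → Fin c) (s : Fin c → Bool) n →
  (∀ j → T (s j) → count (λ x → A x ∧ ⌊ e x ≟ᶠ j ⌋) ≤ n) →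
  count (λ x → A x ∧ s (e x)) ≤ c * n
count-by-colour-≤ {c = c} A e s n small = begin
  count (λ x → A x ∧ s (e x))                             ≡⟨ count-by-colour A e s ⟩
  ∑[ j < c ] (⟦ s j ⟧ * count (λ x → A x ∧ ⌊ e x ≟ᶠ j ⌋)) ≤⟨ ∑-indicator-≤ s _ n small ⟩
  count s * n                                             ≤⟨ *-monoˡ-≤ n (count≤size s) ⟩
  c * n                                                   ∎
  where open ≤-Reasoning

majority : ∀ {N} (p q : Fin N → Bool) → ∃ λ b → count p ≤ 2 * count (λ x → p x ∧ ⌊ q x ≟ᵇ b ⌋)
majority p q = larger (≤-total (part false) (part true))
  where
  part : Bool → ℕ
  part b = count (λ x → p x ∧ ⌊ q x ≟ᵇ b ⌋)
  is-true : ∀ b → b ≡ ⌊ b ≟ᵇ true ⌋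
  is-true true  = refl
  is-true false = refl
  is-false : ∀ b → not b ≡ ⌊ b ≟ᵇ false ⌋
  is-false true  = refl
  is-false false = refl
  parts : count p ≡ part true + part false
  parts = trans (count-split p q)
                (cong₂ _+_ (count-cong (cong (p _ ∧_) ∘ is-true ∘ q))
                           (count-cong (cong (p _ ∧_) ∘ is-false ∘ q)))
  larger : part false ≤ part true ⊎ part true ≤ part false → ∃ λ b → count p ≤ 2 * part b
  larger (inj₁ f≤t) = true , ≤-trans (≤-reflexive parts) (+-monoʳ-≤ (part true) (≤-trans f≤t (m≤m+n _ 0)))
  larger (inj₂ t≤f) = false , ≤-trans (≤-reflexive (trans parts (+-comm (part true) (part false))))
                                      (+-monoʳ-≤ (part false) (≤-trans t≤f (m≤m+n _ 0)))

homogeneous : ∀ {N} m (Q : Fin m → Fin N → Bool) (W₀ : Fin N → Bool) →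
  Σ (Fin N → Bool) λ W → Σ (Fin m → Bool) λ t →
    (∀ v → T (W v) → T (W₀ v) × (∀ j → Q j v ≡ t j)) × count W₀ ≤ 2 ^ m * count W
homogeneous zero    Q W₀ = W₀ , (λ ()) , (λ _ W₀v → W₀v , λ ()) , ≤-reflexive (sym (*-identityˡ _))
homogeneous (suc m) Q W₀ with majority W₀ (Q zero)
... | b , W₀≤2W₁ with homogeneous m (Q ∘ suc) (λ x → W₀ x ∧ ⌊ Q zero x ≟ᵇ b ⌋)
... | W , t , W-homogeneous , W₁≤2^mW = W , b ∷ t , W-homogeneous′ , W₀≤2^[1+m]W
  where
  W-homogeneous′ : ∀ v → T (W v) → T (W₀ v) × (∀ j → Q j v ≡ (b ∷ t) j)
  W-homogeneous′ v Wv with W-homogeneous v Wv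
  ... | W₁v , agree with to T-∧ W₁v
  ...   | W₀v , Q₀v≡b = W₀v , λ { zero → toWitness Q₀v≡b ; (suc j) → agree j }
  W₀≤2^[1+m]W : count W₀ ≤ 2 ^ suc m * count W
  W₀≤2^[1+m]W = begin
    count W₀                                     ≤⟨ W₀≤2W₁ ⟩
    2 * count (λ x → W₀ x ∧ ⌊ Q zero x ≟ᵇ b ⌋) ≤⟨ *-monoʳ-≤ 2 W₁≤2^mW ⟩
    2 * (2 ^ m * count W)                        ≡⟨ *-assoc 2 (2 ^ m) (count W) ⟨
    2 ^ suc m * count W                          ∎
    where open ≤-Reasoning

Increasing : ∀ {m N} → (Fin m → Fin N) → Set
Increasing f = ∀ u v → u F.< v → f u F.< f v

enumerate : ∀ {N} (p : Fin N → Bool) m → m ≤ count p →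
  Σ (Fin m → Fin N) λ g → Increasing g × (∀ j → T (p (g j)))
enumerate p zero _ = (λ ()) , (λ ()) , (λ ())
enumerate {suc N} p (suc m) m<count with p zero in p₀ | m<count
enumerate {suc N} p (suc m) _ | true | s≤s m≤count with enumerate (p ∘ suc) m m≤count
... | g , increasing , member = zero ∷ suc ∘ g , increasing′ , member′
  where
  increasing′ : Increasing (zero ∷ suc ∘ g)
  increasing′ zero    (suc j) _         = z<s
  increasing′ (suc i) (suc j) (s<s i<j) = s<s (increasing i j i<j)
  member′ : ∀ j → T (p ((zero ∷ suc ∘ g) j))
  member′ zero    = subst T (sym p₀) _
  member′ (suc j) = member j
enumerate {suc N} p (suc m) _ | false | m<count′ with enumerate (p ∘ suc) (suc m) m<count′
... | g , increasing , member = suc ∘ g , (λ i j i<j → s<s (increasing i j i<j)) , member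

prefix : ∀ {N} (p : Fin N → Bool) m → m ≤ count p →
  Σ (Fin N → Bool) λ q → (∀ x → T (q x) → T (p x)) × count q ≡ m ×
    count (λ x → p x ∧ not (q x)) ≡ count p ∸ m ×
    (∀ x y → T (q x) → T (p y ∧ not (q y)) → x F.< y)
prefix {N} p zero _ =
  (λ _ → false) , (λ _ ()) , sum-replicate-zero N , count-cong (∧-identityʳ ∘ p) , (λ _ _ ())
prefix {suc N} p (suc m) m<count with p zero in p₀ | m<count
prefix {suc N} p (suc m) _ | true | s≤s m≤count with prefix (p ∘ suc) m m≤count
... | q , q⊆p , count-q , count-rest , q<rest =
  true ∷ q , (λ { zero _ → subst T (sym p₀) _ ; (suc x) → q⊆p x }) , cong suc count-q , count-rest , ordered
  where
  ordered : ∀ x y → T ((true ∷ q) x) → T (p y ∧ not ((true ∷ q) y)) → x F.< y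
  ordered _       zero    _  ry = ⊥-elim (proj₂ (to T-∧ ry))
  ordered zero    (suc y) _  _  = z<s
  ordered (suc x) (suc y) qx ry = s<s (q<rest x y qx ry)
prefix {suc N} p (suc m) _ | false | m<count′ with prefix (p ∘ suc) (suc m) m<count′
... | q , q⊆p , count-q , count-rest , q<rest =
  false ∷ q , (λ { (suc x) → q⊆p x }) , count-q , count-rest , ordered
  where
  ordered : ∀ x y → T ((false ∷ q) x) → T (p y ∧ not ((false ∷ q) y)) → x F.< y
  ordered (suc x) zero    _  ry = ⊥-elim (subst (λ b → T (b ∧ true)) p₀ ry)
  ordered (suc x) (suc y) qx ry = s<s (q<rest x y qx ry)

leftDegree rightDegree : ∀ {N c} → Colouring N c → Fin c → Fin N → ℕ
leftDegree  χ i v = count (λ u → ⌊ u <ᶠ? v ⌋ ∧ ⌊ χ u v ≟ᶠ i ⌋)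
rightDegree χ i v = count (λ w → ⌊ v <ᶠ? w ⌋ ∧ ⌊ χ v w ≟ᶠ i ⌋)

star-copy : ∀ {N c} (χ : Colouring N c) (col : Fin c) r (k : Fin r) v →
  toℕ k ≤ leftDegree χ col v → r ∸ suc (toℕ k) ≤ rightDegree χ col v →
  MonoCopy (star r k) χ col
star-copy {N} χ col r k v enough-left enough-right
  with enumerate (λ u → ⌊ u <ᶠ? v ⌋ ∧ ⌊ χ u v ≟ᶠ col ⌋) (toℕ k) enough-left
     | enumerate (λ w → ⌊ v <ᶠ? w ⌋ ∧ ⌊ χ v w ≟ᶠ col ⌋) (r ∸ suc (toℕ k)) enough-right
... | gL , gL-increasing , left-member | gR , gR-increasing , right-member =
  f , (λ u w → increasing u w (<-cmp (toℕ u) a) (<-cmp (toℕ w) a)) , edge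
  where
  a : ℕ
  a = toℕ k

  gL<v : ∀ j → gL j F.< v
  gL<v j = toWitness {a? = gL j <ᶠ? v} (proj₁ (to T-∧ (left-member j)))
  v<gR : ∀ j → v F.< gR j
  v<gR j = toWitness {a? = v <ᶠ? gR j} (proj₁ (to T-∧ (right-member j)))

  right-index : ∀ j → a < toℕ j → Fin (r ∸ suc a)
  right-index j a<j = fromℕ< (∸-monoˡ-< (toℕ<n j) a<j)

  place : (j : Fin r) → Tri (toℕ j < a) (toℕ j ≡ a) (a < toℕ j) → Fin N
  place j (tri< j<a _ _) = gL (fromℕ< j<a)
  place j (tri≈ _ _ _)   = v
  place j (tri> _ _ a<j) = gR (right-index j a<j)

  f : Fin r → Fin N
  f j = place j (<-cmp (toℕ j) a)

  increasing : ∀ u w tu tw → toℕ u < toℕ w → place u tu F.< place w tw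
  increasing u w (tri< u<a _ _) (tri< w<a _ _) u<w =
    gL-increasing _ _ (subst₂ _<_ (sym (toℕ-fromℕ< u<a)) (sym (toℕ-fromℕ< w<a)) u<w)
  increasing u w (tri< _ _ _)   (tri≈ _ _ _)   _   = gL<v _
  increasing u w (tri< _ _ _)   (tri> _ _ _)   _   = <-trans (gL<v _) (v<gR _)
  increasing u w (tri≈ _ u≡a _) (tri< w<a _ _) u<w = ⊥-elim (<-asym (subst (_< toℕ w) u≡a u<w) w<a)
  increasing u w (tri≈ _ u≡a _) (tri≈ _ w≡a _) u<w = ⊥-elim (<-irrefl (trans u≡a (sym w≡a)) u<w)
  increasing u w (tri≈ _ _ _)   (tri> _ _ _)   _   = v<gR _
  increasing u w (tri> _ _ a<u) (tri< w<a _ _) u<w = ⊥-elim (<-asym a<u (<-trans u<w w<a))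
  increasing u w (tri> _ _ a<u) (tri≈ _ w≡a _) u<w = ⊥-elim (<-asym a<u (subst (toℕ u <_) w≡a u<w))
  increasing u w (tri> _ _ a<u) (tri> _ _ a<w) u<w =
    gR-increasing _ _
      (subst₂ _<_ (sym (toℕ-fromℕ< _)) (sym (toℕ-fromℕ< _)) (∸-monoˡ-< u<w a<u))

  centre : ∀ t → place k t ≡ v
  centre (tri< a<a _ _) = ⊥-elim (<-irrefl refl a<a)
  centre (tri≈ _ _ _)   = refl
  centre (tri> _ _ a<a) = ⊥-elim (<-irrefl refl a<a)

  left-colour : ∀ u t → toℕ u < a → χ (place u t) v ≡ col
  left-colour u (tri< u<a _ _) _   =
    toWitness {a? = χ _ v ≟ᶠ col} (proj₂ (to T-∧ (left-member (fromℕ< u<a))))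
  left-colour u (tri≈ _ u≡a _) u<a = ⊥-elim (<-irrefl u≡a u<a)
  left-colour u (tri> _ _ a<u) u<a = ⊥-elim (<-asym a<u u<a)

  right-colour : ∀ w t → a < toℕ w → χ v (place w t) ≡ col
  right-colour w (tri< w<a _ _) a<w = ⊥-elim (<-asym a<w w<a)
  right-colour w (tri≈ _ w≡a _) a<w = ⊥-elim (<-irrefl (sym w≡a) a<w)
  right-colour w (tri> _ _ a<w) _   =
    toWitness {a? = χ v _ ≟ᶠ col} (proj₂ (to T-∧ (right-member (right-index w a<w))))

  edge : ∀ u w → u F.< w → Adj (star r k) u w → χ (f u) (f w) ≡ col
  edge u w u<w (inj₁ (refl , _)) =
    trans (cong (λ x → χ x (f w)) (centre (<-cmp a a))) (right-colour w (<-cmp (toℕ w) a) u<w)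
  edge u w u<w (inj₂ (refl , _)) =
    trans (cong (χ (f u)) (centre (<-cmp a a))) (left-colour u (<-cmp (toℕ u) a) u<w)

bipartite-count : ∀ {N} (X Y : Fin N → Bool) (R : Fin N → Fin N → Bool) D →
  (∀ y → T (Y y) → count (λ x → X x ∧ R x y) ≤ D) →
  (∀ x → T (X x) → count (λ y → Y y ∧ not (R x y)) ≤ D) →
  count X * count Y ≤ (count X + count Y) * D
bipartite-count {N} X Y R D in-small out-small = begin
  count X * count Y
    ≡⟨ *-distribʳ-sum (count Y) (⟦_⟧ ∘ X) ⟩
  ∑[ x < N ] (⟦ X x ⟧ * count Y)
    ≡⟨ sum-cong-≗ (λ x → *-distribˡ-sum ⟦ X x ⟧ (⟦_⟧ ∘ Y)) ⟩
  ∑[ x < N ] ∑[ y < N ] (⟦ X x ⟧ * ⟦ Y y ⟧)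
    ≡⟨ sum-cong-≗ (λ x → sum-cong-≗ (λ y → split (X x) (Y y) (R x y))) ⟩
  ∑[ x < N ] ∑[ y < N ] (forward x y + backward x y)
    ≡⟨ sum-cong-≗ (λ x → ∑-distrib-+ (forward x) (backward x)) ⟩
  ∑[ x < N ] (sum (forward x) + sum (backward x))
    ≡⟨ ∑-distrib-+ (sum ∘ forward) (sum ∘ backward) ⟩
  ∑[ x < N ] sum (forward x) + ∑[ x < N ] sum (backward x)
    ≡⟨ cong (_+ ∑[ x < N ] sum (backward x)) (∑-comm forward) ⟩
  ∑[ y < N ] ∑[ x < N ] forward x y + ∑[ x < N ] sum (backward x)
    ≡⟨ cong₂ _+_ (sum-cong-≗ (λ y → *-distribˡ-sum ⟦ Y y ⟧ (λ x → ⟦ X x ∧ R x y ⟧)))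
                 (sum-cong-≗ (λ x → *-distribˡ-sum ⟦ X x ⟧ (λ y → ⟦ Y y ∧ not (R x y) ⟧))) ⟨
  ∑[ y < N ] (⟦ Y y ⟧ * count (λ x → X x ∧ R x y)) + ∑[ x < N ] (⟦ X x ⟧ * count (λ y → Y y ∧ not (R x y)))
    ≤⟨ +-mono-≤ (∑-indicator-≤ Y _ D in-small) (∑-indicator-≤ X _ D out-small) ⟩
  count Y * D + count X * D
    ≡⟨ +-comm (count Y * D) (count X * D) ⟩
  count X * D + count Y * D
    ≡⟨ *-distribʳ-+ D (count X) (count Y) ⟨
  (count X + count Y) * D
    ∎
  where
  open ≤-Reasoning
  forward backward : Fin N → Fin N → ℕ
  forward  x y = ⟦ Y y ⟧ * ⟦ X x ∧ R x y ⟧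
  backward x y = ⟦ X x ⟧ * ⟦ Y y ∧ not (R x y) ⟧
  split : ∀ a b r → ⟦ a ⟧ * ⟦ b ⟧ ≡ ⟦ b ⟧ * ⟦ a ∧ r ⟧ + ⟦ a ⟧ * ⟦ b ∧ not r ⟧
  split true  true  true  = refl
  split true  true  false = refl
  split true  false _     = refl
  split false true  _     = refl
  split false false _     = refl

product-beats-sum : ∀ D x y → 2 * D < x → 2 * D < y → (x + y) * D < x * y
product-beats-sum D (suc x) y 2D<x 2D<y = *-cancelˡ-< 2 ((suc x + y) * D) (suc x * y) (begin-strict
  2 * ((suc x + y) * D)         ≡⟨ double-sum (suc x) y D ⟩
  suc x * (2 * D) + y * (2 * D) <⟨ +-mono-<-≤ (*-monoʳ-< (suc x) 2D<y) (*-monoʳ-≤ y (<⇒≤ 2D<x)) ⟩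
  suc x * y + y * suc x         ≡⟨ double-product (suc x) y ⟩
  2 * (suc x * y)               ∎)
  where
  open ≤-Reasoning
  double-sum : ∀ x y D → 2 * ((x + y) * D) ≡ x * (2 * D) + y * (2 * D)
  double-sum = solve-∀
  double-product : ∀ x y → x * y + y * x ≡ 2 * (x * y)
  double-product = solve-∀

starless-colouring-small : ∀ {N c} (χ : Colouring N c) (a b : Fin c → ℕ) n →
  (∀ i → a i ≤ n) → (∀ i → b i ≤ n) →
  (∀ v i → leftDegree χ i v < a i ⊎ rightDegree χ i v < b i) →
  N < 2 ^ c * (2 * suc (2 * (c * n)))
starless-colouring-small {N} {c} χ a b n a≤n b≤n starless = ≰⇒> large-impossible
  where
  D M : ℕ
  D = c * n
  M = suc (2 * D)

  type : Fin c → Fin N → Bool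
  type i v = ⌊ leftDegree χ i v <? a i ⌋

  class-large : ∀ {W : Fin N → Bool} → 2 ^ c * (2 * M) ≤ N →
    count {N} (λ _ → true) ≤ 2 ^ c * count W → 2 * M ≤ count W
  class-large big N≤2^cW =
    *-cancelˡ-≤ (2 ^ c) {{m^n≢0 2 c}}
      (≤-trans big (≤-trans (≤-reflexive (sym (count-all N))) N≤2^cW))

  large-impossible : ¬ (2 ^ c * (2 * M) ≤ N)
  large-impossible big with homogeneous c type (λ _ → true)
  ... | W , t , W-homogeneous , N≤2^cW
    with prefix W M (≤-trans (m≤m+n M (M + 0)) (class-large big N≤2^cW))
  ... | X , X⊆W , |X|≡M , |Y|≡|W|∸M , X<Y =
    <⇒≱ (product-beats-sum D (count X) (count Y) (≤-reflexive (sym |X|≡M)) Y-large)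
        (bipartite-count X Y (λ x y → t (χ x y)) D in-small out-small)
    where
    Y : Fin N → Bool
    Y y = W y ∧ not (X y)

    Y-large : M ≤ count Y
    Y-large = begin
      M                   ≡⟨ trans (m+n∸m≡n M (M + 0)) (+-identityʳ M) ⟨
      2 * M ∸ M           ≤⟨ ∸-monoˡ-≤ M (class-large big N≤2^cW) ⟩
      count W ∸ M         ≡⟨ |Y|≡|W|∸M ⟨
      count Y             ∎
      where open ≤-Reasoning

    agrees : ∀ v → T (W v) → ∀ i → type i v ≡ t i
    agrees v Wv = proj₂ (W-homogeneous v Wv)

    left-small : ∀ v → T (W v) → ∀ i → T (t i) → leftDegree χ i v ≤ n
    left-small v Wv i ti =
      <⇒≤ (<-≤-trans (toWitness {a? = leftDegree χ i v <? a i} (subst T (sym (agrees v Wv i)) ti))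
                     (a≤n i))

    right-small : ∀ v → T (W v) → ∀ i → T (not (t i)) → rightDegree χ i v ≤ n
    right-small v Wv i ¬ti with starless v i
    ... | inj₂ R<b = <⇒≤ (<-≤-trans R<b (b≤n i))
    ... | inj₁ L<a = ⊥-elim (toWitnessFalse {a? = leftDegree χ i v <? a i}
                                (subst (T ∘ not) (sym (agrees v Wv i)) ¬ti) L<a)

    in-small : ∀ y → T (Y y) → count (λ x → X x ∧ t (χ x y)) ≤ D
    in-small y Yy = ≤-trans (count-mono before)
      (count-by-colour-≤ (λ x → ⌊ x <ᶠ? y ⌋) (λ x → χ x y) t n (left-small y (proj₁ (to T-∧ Yy))))
      where
      before : ∀ x → T (X x ∧ t (χ x y)) → T (⌊ x <ᶠ? y ⌋ ∧ t (χ x y))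
      before x Xx∧t with to T-∧ Xx∧t
      ... | Xx , tx = from T-∧ (fromWitness (X<Y x y Xx Yy) , tx)

    out-small : ∀ x → T (X x) → count (λ y → Y y ∧ not (t (χ x y))) ≤ D
    out-small x Xx = ≤-trans (count-mono after)
      (count-by-colour-≤ (λ y → ⌊ x <ᶠ? y ⌋) (χ x) (not ∘ t) n (right-small x (X⊆W x Xx)))
      where
      after : ∀ y → T (Y y ∧ not (t (χ x y))) → T (⌊ x <ᶠ? y ⌋ ∧ not (t (χ x y)))
      after y Yy∧¬t with to T-∧ Yy∧¬t
      ... | Yy , ¬ty = from T-∧ (fromWitness (X<Y x y Xx Yy) , ¬ty)

ordered-stars-arrow : ∀ {c} N (r : Fin c → ℕ) (k : (i : Fin c) → Fin (r i)) n → (∀ i → r i ≤ n) →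
  2 ^ c * (2 * suc (2 * (c * n))) ≤ N → Arrows N (λ i → star (r i) (k i))
ordered-stars-arrow {c} N r k n r≤n big χ =
  decide (any? λ v → any? λ i → (a i ≤? leftDegree χ i v) ×-dec (b i ≤? rightDegree χ i v))
  where
  a b : Fin c → ℕ
  a i = toℕ (k i)
  b i = r i ∸ suc (toℕ (k i))

  decide : Dec (∃ λ v → ∃ λ i → a i ≤ leftDegree χ i v × b i ≤ rightDegree χ i v) →
    ∃ λ i → MonoCopy (star (r i) (k i)) χ i
  decide (yes (v , i , enough-left , enough-right)) =
    i , star-copy χ i (r i) (k i) v enough-left enough-right
  decide (no no-centre) = ⊥-elim (<⇒≱ (starless-colouring-small χ a b n a≤n b≤n starless) big)
    where
    a≤n : ∀ i → a i ≤ n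
    a≤n i = ≤-trans (<⇒≤ (toℕ<n (k i))) (r≤n i)
    b≤n : ∀ i → b i ≤ n
    b≤n i = ≤-trans (m∸n≤m (r i) (suc (toℕ (k i)))) (r≤n i)
    starless : ∀ v i → leftDegree χ i v < a i ⊎ rightDegree χ i v < b i
    starless v i with leftDegree χ i v <? a i | rightDegree χ i v <? b i
    ... | yes L<a | _       = inj₁ L<a
    ... | no _    | yes R<b = inj₂ R<b
    ... | no L≮a  | no R≮b  = ⊥-elim (no-centre (v , i , ≮⇒≥ L≮a , ≮⇒≥ R≮b))

≤-maxOf : ∀ {c} (r : Fin c → ℕ) i → r i ≤ maxOf r
≤-maxOf r zero    = m≤m⊔n (r zero) _
≤-maxOf r (suc i) = ≤-trans (≤-maxOf (r ∘ suc) i) (m≤n⊔m (r zero) _)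

size-bound : ∀ c n → 1 ≤ n → 2 ^ c * (2 * suc (2 * (c * n))) ≤ 2 ^ c * (4 * c + 2) * n
size-bound c n 1≤n = begin
  2 ^ c * (2 * suc (2 * (c * n)))   ≡⟨ cong (2 ^ c *_) (expand-constant c n) ⟩
  2 ^ c * (4 * (c * n) + 2 * 1)     ≤⟨ *-monoʳ-≤ (2 ^ c) (+-monoʳ-≤ (4 * (c * n)) (*-monoʳ-≤ 2 1≤n)) ⟩
  2 ^ c * (4 * (c * n) + 2 * n)     ≡⟨ cong (2 ^ c *_) (expand-linear c n) ⟨
  2 ^ c * ((4 * c + 2) * n)         ≡⟨ *-assoc (2 ^ c) (4 * c + 2) n ⟨
  2 ^ c * (4 * c + 2) * n           ∎
  where
  open ≤-Reasoning
  expand-constant : ∀ c n → 2 * suc (2 * (c * n)) ≡ 4 * (c * n) + 2 * 1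
  expand-constant = solve-∀
  expand-linear : ∀ c n → (4 * c + 2) * n ≡ 4 * (c * n) + 2 * n
  expand-linear = solve-∀

theorem3 : (c : ℕ) → 1 ≤ c →
    ∃ λ (C : ℕ) →
      (r : Fin c → ℕ) → (∀ i → 1 ≤ r i) →
      (k : (i : Fin c) → Fin (r i)) →
      ∃ λ (N : ℕ) → N ≤ C * maxOf r × Arrows N (λ i → star (r i) (k i))
theorem3 zero      ()
theorem3 c@(suc _) _ = C , λ r r≥1 k →
  let n = maxOf r in
  C * n , ≤-refl ,
  ordered-stars-arrow (C * n) r k n (≤-maxOf r) (size-bound c n (≤-trans (r≥1 zero) (≤-maxOf r zero)))
  where
  C : ℕ
  C = 2 ^ c * (4 * c + 2)
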